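{- Let $\alpha\in\mathbb Z\setminus\{0,1\}$, put $\gamma=\alpha^2-\alpha+1$, and let $(h_n)$ be the sequence with $h_0=0$, $h_1=1$, $h_2=-\alpha^2(\alpha-1)\gamma$, $h_3=-\alpha^6(\alpha-1)^3\gamma^3$, $h_4=\alpha^{12}(\alpha-1)^6\gamma^5$, and for $m\ge2$: $h_{2m+1}=h_{m+2}h_m^3-h_{m-1}h_{m+1}^3$, for $m\ge 3$: $h_{2m}=h_m\big(h_{m+2}h_{m-1}^2-h_{m-2}h_{m+1}^2\big)/h_2$. (i) If $n\equiv 1,3,6,12,15,21,24,26\pmod{27}$, then $h_n$ is a cube. (ii) If $n\equiv 4,23\pmod{27}$, then $h_n$ is a cube if and only if $(\alpha^2-\alpha+1)^2$ is a cube.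
   Context: The sequence defined is the elliptic divisibility sequence attached to the point $(0,0)$ of order $9$ on the Tate normal form curve with $c=\alpha^2(\alpha-1)$, $b=c(\alpha(\alpha-1)+1)$. Convention: an integer $m$ is called a cube if $m=\beta^3$ for some nonzero integer $\beta$. -}

module Defs where

open import Data.Nat as ℕ using (ℕ; _≤_)
open import Data.Integer using (ℤ; _+_; _-_; _*_; _^_; -_; +_; 0ℤ; 1ℤ)
open import Data.Product using (Σ; _×_)
open import Relation.Binary.PropositionalEquality using (_≡_; _≢_)

γ : ℤ → ℤ
γ α = α ^ 2 - α + 1ℤ

IsCube : ℤ → Set
IsCube m = Σ ℤ (λ β → (β ≢ 0ℤ) × (m ≡ β ^ 3))

-- The even-index recurrence h_{2m} = h_m (…) / h_2 is stated in the
-- equivalent multiplied-out form h_2 · h_{2m} = h_m (…); since h_2 ≠ 0 for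
-- α ∉ {0,1}, this determines h_{2m} uniquely (and encodes exactness of the
-- division, which the paper's definition presupposes).
record IsHSeq (α : ℤ) (h : ℕ → ℤ) : Set where
  field
    h0 : h 0 ≡ 0ℤ
    h1 : h 1 ≡ 1ℤ
    h2 : h 2 ≡ - (α ^ 2 * (α - 1ℤ) * γ α)
    h3 : h 3 ≡ - (α ^ 6 * (α - 1ℤ) ^ 3 * γ α ^ 3)
    h4 : h 4 ≡ α ^ 12 * (α - 1ℤ) ^ 6 * γ α ^ 5
    odd : ∀ m → 2 ≤ m →
      h (2 ℕ.* m ℕ.+ 1) ≡ h (m ℕ.+ 2) * h m ^ 3 - h (m ℕ.∸ 1) * h (m ℕ.+ 1) ^ 3
    even : ∀ m → 3 ≤ m →
      h 2 * h (2 ℕ.* m) ≡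
        h m * (h (m ℕ.+ 2) * h (m ℕ.∸ 1) ^ 2 - h (m ℕ.∸ 2) * h (m ℕ.+ 1) ^ 2)

module Submission where

-- The sequence has a closed form: for n = 9q + r,
--   h n = h r · A^(q²) · B^(q r),  A = −α⁶³(α−1)³⁶γ²⁷,  B = α¹⁴(α−1)⁸γ⁶,
-- where h 1, …, h 8 are signed monomials in α, α − 1, γ and h 0 = 0.
--  * QuasiPeriodic: for any A, B with A² = Bᴺ, such a quasi-periodic extension
--    W of values on residues satisfies both recurrences everywhere as soon as
--    it does on one window of N consecutive indices.
--  * Monomials, Order9: for N = 9 the window is checked by cancelling the common
--    monomial factor of the three terms of each recurrence; what is left are
--    six small identities between 1, α, α − 1 and γ.
--  * hseq-unique: the recurrences determine the sequence once h 2 ≠ 0, so h = W.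
--  * Cubicity: three blocks up, W gets multiplied by a nonzero cube, so whether
--    h n is a cube depends on n mod 27 only (cube-factor cancels the cube); for
--    the listed residues the exponents of h t are multiples of 3, respectively
--    those of γ² times a cube.

open import Defs
open import Data.Nat using (ℕ; _%_)
open import Data.Integer using (ℤ; _^_; 0ℤ; 1ℤ)
open import Data.Product using (_×_)
open import Data.Sum using (_⊎_)
open import Relation.Binary.PropositionalEquality using (_≡_; _≢_)
open import Function.Bundles using (_⇔_; mk⇔; Equivalence)
open import Function.Properties.Equivalence using () renaming (trans to ⇔-trans)

import Data.Nat as ℕ
import Data.Nat.Properties as ℕ
open import Data.Nat.Divisibility using (_∣_; ∣-trans; m∣m*n; n∣m*n; ∣1⇒≡1)
open import Data.Nat.Induction using (<-rec)
open import Data.Nat.DivMod using (m/n*n≡m; m≡m%n+[m/n]*n; [m+kn]%n≡m%n; +-distrib-/-∣ʳ; m*n/n≡m; m%n<n)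
open import Data.Nat.GCD using (gcd; gcd[m,n]≢0; gcd[m,n]∣m; gcd[m,n]∣n)
open import Data.Nat.Coprimality using (Coprime; coprime-divisor; coprime-/gcd)
import Data.Nat.Tactic.RingSolver as ℕ-Solver
open import Data.Bool using (T)
open import Data.Maybe using (Maybe; just; nothing)
open import Data.Unit using (⊤)
open import Data.Integer using (NonZero; ≢-nonZero; -1ℤ; _+_; _*_; _-_; -_; +_; -[1+_]; ∣_∣)
open import Data.Integer.Properties
  using (*-assoc; *-identityˡ; *-identityʳ; *-zeroʳ; *-cancelˡ-≡; ^-distribˡ-+-*; ^-*-assoc;
         abs-*; pos-*; ∣i∣≡0⇒i≡0; i^n≡0⇒i≡0; i*j≡0⇒i≡0∨j≡0)
open import Data.Integer.Tactic.RingSolver using (solve-∀)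
open import Data.Product using (Σ; _,_; proj₁; proj₂)
open import Data.Sum using (inj₁; inj₂; [_,_]′)
open import Relation.Binary.PropositionalEquality using (refl; sym; trans; cong; cong₂; subst; module ≡-Reasoning)
open ≡-Reasoning

interchange : ∀ a b c d → a * b * (c * d) ≡ a * c * (b * d)
interchange = solve-∀

*-distribʳ-- : ∀ x y z → (x - y) * z ≡ x * z - y * z
*-distribʳ-- = solve-∀

*-distribˡ-- : ∀ x y z → x * (y - z) ≡ x * y - x * z
*-distribˡ-- = solve-∀

*-^ : ∀ x y n → (x * y) ^ n ≡ x ^ n * y ^ n
*-^ x y ℕ.zero    = refl
*-^ x y (ℕ.suc n) = trans (cong (x * y *_) (*-^ x y n)) (interchange x y (x ^ n) (y ^ n))

*-≢0 : ∀ {x y} → x ≢ 0ℤ → y ≢ 0ℤ → x * y ≢ 0ℤ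
*-≢0 {x} x≢0 y≢0 xy≡0 = [ x≢0 , y≢0 ]′ (i*j≡0⇒i≡0∨j≡0 x xy≡0)

^-≢0 : ∀ {x} n → x ≢ 0ℤ → x ^ n ≢ 0ℤ
^-≢0 {x} n x≢0 xⁿ≡0 = x≢0 (i^n≡0⇒i≡0 x n xⁿ≡0)

cube-* : ∀ {x y} → IsCube x → IsCube y → IsCube (x * y)
cube-* (β , β≢0 , refl) (δ , δ≢0 , refl) = β * δ , *-≢0 β≢0 δ≢0 , sym (*-^ β δ 3)

-- In ℕ, x y³ = z³ with y ≠ 0 forces x to be a cube: after dividing y and z
-- by d = gcd y z they become coprime, and y/d ∣ (z/d)³ then forces y/d = 1.
ℕ-cube-cancel : ∀ x y z → y ≢ 0 → x ℕ.* y ℕ.^ 3 ≡ z ℕ.^ 3 → Σ ℕ λ w → x ≡ w ℕ.^ 3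
ℕ-cube-cancel x y z y≢0 eq = z′ , x≡z′³
  where
  d  = gcd y z
  instance
    d≢0 : ℕ.NonZero d
    d≢0 = ℕ.≢-nonZero (gcd[m,n]≢0 y z (inj₁ y≢0))
    d³≢0 : ℕ.NonZero (d ℕ.^ 3)
    d³≢0 = ℕ.m^n≢0 d 3
  y′ = y ℕ./ d
  z′ = z ℕ./ d
  -- a (b c)³ = a b³ c³, with the cubes unfolded for the solver
  distrib³ : ∀ a b c → a ℕ.* ((b ℕ.* c) ℕ.* ((b ℕ.* c) ℕ.* ((b ℕ.* c) ℕ.* 1)))
                     ≡ a ℕ.* (b ℕ.* (b ℕ.* (b ℕ.* 1))) ℕ.* (c ℕ.* (c ℕ.* (c ℕ.* 1)))
  distrib³ = ℕ-Solver.solve-∀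
  reduced : x ℕ.* y′ ℕ.^ 3 ≡ z′ ℕ.^ 3
  reduced = ℕ.*-cancelʳ-≡ _ _ (d ℕ.^ 3) (begin
    x ℕ.* y′ ℕ.^ 3 ℕ.* d ℕ.^ 3   ≡⟨ sym (distrib³ x y′ d) ⟩
    x ℕ.* (y′ ℕ.* d) ℕ.^ 3       ≡⟨ cong (λ u → x ℕ.* u ℕ.^ 3) (m/n*n≡m (gcd[m,n]∣m y z)) ⟩
    x ℕ.* y ℕ.^ 3                ≡⟨ eq ⟩
    z ℕ.^ 3                      ≡⟨ cong (ℕ._^ 3) (sym (m/n*n≡m (gcd[m,n]∣n y z))) ⟩
    (z′ ℕ.* d) ℕ.^ 3             ≡⟨ sym (ℕ.*-identityˡ ((z′ ℕ.* d) ℕ.^ 3)) ⟩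
    1 ℕ.* (z′ ℕ.* d) ℕ.^ 3       ≡⟨ distrib³ 1 z′ d ⟩
    1 ℕ.* z′ ℕ.^ 3 ℕ.* d ℕ.^ 3   ≡⟨ cong (ℕ._* d ℕ.^ 3) (ℕ.*-identityˡ (z′ ℕ.^ 3)) ⟩
    z′ ℕ.^ 3 ℕ.* d ℕ.^ 3         ∎)
  coprime : Coprime y′ z′
  coprime = coprime-/gcd y z
  y′∣z′³ : y′ ∣ z′ ℕ.* (z′ ℕ.* (z′ ℕ.* 1))
  y′∣z′³ = subst (y′ ∣_) reduced (∣-trans (m∣m*n (y′ ℕ.* (y′ ℕ.* 1))) (n∣m*n x))
  y′≡1 : y′ ≡ 1
  y′≡1 = ∣1⇒≡1 (coprime-divisor coprime (coprime-divisor coprime (coprime-divisor coprime y′∣z′³)))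
  x≡z′³ : x ≡ z′ ℕ.^ 3
  x≡z′³ = trans (sym (ℕ.*-identityʳ x)) (trans (cong (λ u → x ℕ.* u ℕ.^ 3) (sym y′≡1)) reduced)

abs-^ : ∀ x n → ∣ x ^ n ∣ ≡ ∣ x ∣ ℕ.^ n
abs-^ x ℕ.zero    = refl
abs-^ x (ℕ.suc n) = trans (abs-* x (x ^ n)) (cong (∣ x ∣ ℕ.*_) (abs-^ x n))

pos-^ : ∀ m n → + (m ℕ.^ n) ≡ (+ m) ^ n
pos-^ m ℕ.zero    = refl
pos-^ m (ℕ.suc n) = trans (pos-* m (m ℕ.^ n)) (cong (+ m *_) (pos-^ m n))

abs-cube : ∀ x w → ∣ x ∣ ≡ w ℕ.^ 3 → Σ ℤ λ v → x ≡ v ^ 3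
abs-cube (+ n)    w refl = + w , pos-^ w 3
abs-cube -[1+ n ] w eq   = - (+ w) , (begin
  - (+ ℕ.suc n)  ≡⟨ cong (λ m → - (+ m)) eq ⟩
  - (+ w ℕ.^ 3)  ≡⟨ cong -_ (pos-^ w 3) ⟩
  - (+ w) ^ 3    ≡⟨ neg-cube (+ w) ⟩
  (- (+ w)) ^ 3  ∎)
  where
  -- −(a³) = (−a)³, with the cubes unfolded for the solver
  neg-cube : ∀ a → - (a * (a * (a * 1ℤ))) ≡ - a * (- a * (- a * 1ℤ))
  neg-cube = solve-∀

cube-cancel : ∀ {x y} → y ≢ 0ℤ → IsCube (x * y ^ 3) → IsCube x
cube-cancel {x} {y} y≢0 (β , β≢0 , xy³≡β³) = v , v≢0 , x≡v³
  where
  ∣y∣≢0 : ∣ y ∣ ≢ 0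
  ∣y∣≢0 ∣y∣≡0 = y≢0 (∣i∣≡0⇒i≡0 ∣y∣≡0)
  abs-equation : ∣ x ∣ ℕ.* ∣ y ∣ ℕ.^ 3 ≡ ∣ β ∣ ℕ.^ 3
  abs-equation = begin
    ∣ x ∣ ℕ.* ∣ y ∣ ℕ.^ 3  ≡⟨ cong (∣ x ∣ ℕ.*_) (sym (abs-^ y 3)) ⟩
    ∣ x ∣ ℕ.* ∣ y ^ 3 ∣    ≡⟨ sym (abs-* x (y ^ 3)) ⟩
    ∣ x * y ^ 3 ∣          ≡⟨ cong ∣_∣ xy³≡β³ ⟩
    ∣ β ^ 3 ∣              ≡⟨ abs-^ β 3 ⟩
    ∣ β ∣ ℕ.^ 3            ∎
  ∣x∣-root = ℕ-cube-cancel (∣ x ∣) (∣ y ∣) (∣ β ∣) ∣y∣≢0 abs-equation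
  root = abs-cube x (proj₁ ∣x∣-root) (proj₂ ∣x∣-root)
  v = proj₁ root
  x≡v³ : x ≡ v ^ 3
  x≡v³ = proj₂ root
  v≢0 : v ≢ 0ℤ
  v≢0 v≡0 = β≢0 (i^n≡0⇒i≡0 β 3 (begin
    β ^ 3      ≡⟨ sym xy³≡β³ ⟩
    x * y ^ 3  ≡⟨ cong (λ u → u * y ^ 3) (trans x≡v³ (cong (_^ 3) v≡0)) ⟩
    0ℤ         ∎))

cube-factor : ∀ {x y} → y ≢ 0ℤ → IsCube (x * y ^ 3) ⇔ IsCube x
cube-factor {y = y} y≢0 = mk⇔ (cube-cancel y≢0) (λ x-cube → cube-* x-cube (y , y≢0 , refl))

OddRel : (ℕ → ℤ) → ℕ → Set
OddRel h m = h (2 ℕ.* m ℕ.+ 1) ≡ h (m ℕ.+ 2) * h m ^ 3 - h (m ℕ.∸ 1) * h (m ℕ.+ 1) ^ 3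

EvenRel : (ℕ → ℤ) → ℕ → Set
EvenRel h m = h 2 * h (2 ℕ.* m) ≡
  h m * (h (m ℕ.+ 2) * h (m ℕ.∸ 1) ^ 2 - h (m ℕ.∸ 2) * h (m ℕ.+ 1) ^ 2)

-- Given A, B with A² = Bᴺ, put θ q s = A^(q²) B^(q s)
-- and extend c from the residues modulo N by W (N q + r) = c r · θ q r.  Then
-- W (N q + s) = W s · θ q s for every s, and since θ is "quadratic" in the block
-- index, both recurrences propagate from a window of N consecutive indices to
-- all indices.
module QuasiPeriodic (N : ℕ) .{{_ : ℕ.NonZero N}} (A B : ℤ) (A²≡Bᴺ : A ^ 2 ≡ B ^ N) where

  pw : ℕ → ℕ → ℤ
  pw a b = A ^ a * B ^ b

  pw-* : ∀ a b c d → pw a b * pw c d ≡ pw (a ℕ.+ c) (b ℕ.+ d)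
  pw-* a b c d = begin
    A ^ a * B ^ b * (A ^ c * B ^ d)    ≡⟨ interchange (A ^ a) (B ^ b) (A ^ c) (B ^ d) ⟩
    A ^ a * A ^ c * (B ^ b * B ^ d)    ≡⟨ sym (cong₂ _*_ (^-distribˡ-+-* A a c) (^-distribˡ-+-* B b d)) ⟩
    A ^ (a ℕ.+ c) * B ^ (b ℕ.+ d)      ∎

  pw-^ : ∀ a b n → pw a b ^ n ≡ pw (n ℕ.* a) (n ℕ.* b)
  pw-^ a b ℕ.zero    = refl
  pw-^ a b (ℕ.suc n) = trans (cong (pw a b *_) (pw-^ a b n)) (pw-* a b (n ℕ.* a) (n ℕ.* b))

  -- A² = Bᴺ lets a factor A^(2k) be traded for B^(N k).
  pw-trade : ∀ a b k → pw (a ℕ.+ 2 ℕ.* k) b ≡ pw a (b ℕ.+ N ℕ.* k)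
  pw-trade a b k = begin
    A ^ (a ℕ.+ 2 ℕ.* k) * B ^ b        ≡⟨ cong (_* B ^ b) (^-distribˡ-+-* A a (2 ℕ.* k)) ⟩
    A ^ a * A ^ (2 ℕ.* k) * B ^ b      ≡⟨ cong (λ t → A ^ a * t * B ^ b) A²ᵏ≡Bᴺᵏ ⟩
    A ^ a * B ^ (N ℕ.* k) * B ^ b      ≡⟨ rotate (A ^ a) (B ^ (N ℕ.* k)) (B ^ b) ⟩
    A ^ a * (B ^ b * B ^ (N ℕ.* k))    ≡⟨ cong (A ^ a *_) (sym (^-distribˡ-+-* B b (N ℕ.* k))) ⟩
    A ^ a * B ^ (b ℕ.+ N ℕ.* k)        ∎
    where
    A²ᵏ≡Bᴺᵏ : A ^ (2 ℕ.* k) ≡ B ^ (N ℕ.* k)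
    A²ᵏ≡Bᴺᵏ = trans (sym (^-*-assoc A 2 k)) (trans (cong (_^ k) A²≡Bᴺ) (^-*-assoc B N k))
    rotate : ∀ x y z → x * y * z ≡ x * (z * y)
    rotate = solve-∀

  θ : ℕ → ℕ → ℤ
  θ q s = pw (q ℕ.* q) (q ℕ.* s)

  -- Splitting the block index q + p (the cross term 2pq is traded for B^(N p q)).
  θ-shift : ∀ p q r → θ (q ℕ.+ p) r ≡ θ p r * θ q (N ℕ.* p ℕ.+ r)
  θ-shift p q r = begin
    pw ((q ℕ.+ p) ℕ.* (q ℕ.+ p)) ((q ℕ.+ p) ℕ.* r)
      ≡⟨ cong (λ a → pw a ((q ℕ.+ p) ℕ.* r)) (square p q) ⟩
    pw (p ℕ.* p ℕ.+ q ℕ.* q ℕ.+ 2 ℕ.* (q ℕ.* p)) ((q ℕ.+ p) ℕ.* r)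
      ≡⟨ pw-trade (p ℕ.* p ℕ.+ q ℕ.* q) ((q ℕ.+ p) ℕ.* r) (q ℕ.* p) ⟩
    pw (p ℕ.* p ℕ.+ q ℕ.* q) ((q ℕ.+ p) ℕ.* r ℕ.+ N ℕ.* (q ℕ.* p))
      ≡⟨ cong (pw (p ℕ.* p ℕ.+ q ℕ.* q)) (linear N p q r) ⟩
    pw (p ℕ.* p ℕ.+ q ℕ.* q) (p ℕ.* r ℕ.+ q ℕ.* (N ℕ.* p ℕ.+ r))
      ≡⟨ sym (pw-* (p ℕ.* p) (p ℕ.* r) (q ℕ.* q) (q ℕ.* (N ℕ.* p ℕ.+ r))) ⟩
    θ p r * θ q (N ℕ.* p ℕ.+ r) ∎
    where
    square : ∀ p q → (q ℕ.+ p) ℕ.* (q ℕ.+ p) ≡ p ℕ.* p ℕ.+ q ℕ.* q ℕ.+ 2 ℕ.* (q ℕ.* p)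
    square = ℕ-Solver.solve-∀
    linear : ∀ N p q r → (q ℕ.+ p) ℕ.* r ℕ.+ N ℕ.* (q ℕ.* p) ≡ p ℕ.* r ℕ.+ q ℕ.* (N ℕ.* p ℕ.+ r)
    linear = ℕ-Solver.solve-∀

  θ-double : ∀ q w → pw (4 ℕ.* (q ℕ.* q)) (q ℕ.* (2 ℕ.* w)) ≡ θ (2 ℕ.* q) w
  θ-double q w = cong₂ pw (quadratic q) (linear q w)
    where
    quadratic : ∀ q → 4 ℕ.* (q ℕ.* q) ≡ 2 ℕ.* q ℕ.* (2 ℕ.* q)
    quadratic = ℕ-Solver.solve-∀
    linear : ∀ q w → q ℕ.* (2 ℕ.* w) ≡ 2 ℕ.* q ℕ.* w
    linear = ℕ-Solver.solve-∀

  θ-odd : ∀ q s t w → s ℕ.+ 3 ℕ.* t ≡ 2 ℕ.* w → θ q s * θ q t ^ 3 ≡ θ (2 ℕ.* q) w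
  θ-odd q s t w s+3t≡2w = begin
    θ q s * θ q t ^ 3
      ≡⟨ cong (θ q s *_) (pw-^ (q ℕ.* q) (q ℕ.* t) 3) ⟩
    θ q s * pw (3 ℕ.* (q ℕ.* q)) (3 ℕ.* (q ℕ.* t))
      ≡⟨ pw-* (q ℕ.* q) (q ℕ.* s) _ _ ⟩
    pw (q ℕ.* q ℕ.+ 3 ℕ.* (q ℕ.* q)) (q ℕ.* s ℕ.+ 3 ℕ.* (q ℕ.* t))
      ≡⟨ cong₂ pw (quadratic q) (trans (linear q s t) (cong (q ℕ.*_) s+3t≡2w)) ⟩
    pw (4 ℕ.* (q ℕ.* q)) (q ℕ.* (2 ℕ.* w))
      ≡⟨ θ-double q w ⟩
    θ (2 ℕ.* q) w ∎
    where
    quadratic : ∀ q → q ℕ.* q ℕ.+ 3 ℕ.* (q ℕ.* q) ≡ 4 ℕ.* (q ℕ.* q)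
    quadratic = ℕ-Solver.solve-∀
    linear : ∀ q s t → q ℕ.* s ℕ.+ 3 ℕ.* (q ℕ.* t) ≡ q ℕ.* (s ℕ.+ 3 ℕ.* t)
    linear = ℕ-Solver.solve-∀

  θ-even : ∀ q s t u w → s ℕ.+ (t ℕ.+ 2 ℕ.* u) ≡ 2 ℕ.* w →
           θ q s * (θ q t * θ q u ^ 2) ≡ θ (2 ℕ.* q) w
  θ-even q s t u w s+t+2u≡2w = begin
    θ q s * (θ q t * θ q u ^ 2)
      ≡⟨ cong (λ x → θ q s * (θ q t * x)) (pw-^ (q ℕ.* q) (q ℕ.* u) 2) ⟩
    θ q s * (θ q t * pw (2 ℕ.* (q ℕ.* q)) (2 ℕ.* (q ℕ.* u)))
      ≡⟨ cong (θ q s *_) (pw-* (q ℕ.* q) (q ℕ.* t) _ _) ⟩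
    θ q s * pw (q ℕ.* q ℕ.+ 2 ℕ.* (q ℕ.* q)) (q ℕ.* t ℕ.+ 2 ℕ.* (q ℕ.* u))
      ≡⟨ pw-* (q ℕ.* q) (q ℕ.* s) _ _ ⟩
    pw (q ℕ.* q ℕ.+ (q ℕ.* q ℕ.+ 2 ℕ.* (q ℕ.* q)))
       (q ℕ.* s ℕ.+ (q ℕ.* t ℕ.+ 2 ℕ.* (q ℕ.* u)))
      ≡⟨ cong₂ pw (quadratic q) (trans (linear q s t u) (cong (q ℕ.*_) s+t+2u≡2w)) ⟩
    pw (4 ℕ.* (q ℕ.* q)) (q ℕ.* (2 ℕ.* w))
      ≡⟨ θ-double q w ⟩
    θ (2 ℕ.* q) w ∎
    where
    quadratic : ∀ q → q ℕ.* q ℕ.+ (q ℕ.* q ℕ.+ 2 ℕ.* (q ℕ.* q)) ≡ 4 ℕ.* (q ℕ.* q)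
    quadratic = ℕ-Solver.solve-∀
    linear : ∀ q s t u → q ℕ.* s ℕ.+ (q ℕ.* t ℕ.+ 2 ℕ.* (q ℕ.* u)) ≡ q ℕ.* (s ℕ.+ (t ℕ.+ 2 ℕ.* u))
    linear = ℕ-Solver.solve-∀

  module Extension (c : ℕ → ℤ) where

    W : ℕ → ℤ
    W n = c (n ℕ.% N) * θ (n ℕ./ N) (n ℕ.% N)

    W-shift : ∀ q s → W (N ℕ.* q ℕ.+ s) ≡ W s * θ q s
    W-shift q s = begin
      W (N ℕ.* q ℕ.+ s)                  ≡⟨ cong₂ (λ a b → c b * θ a b) quotient remainder ⟩
      c r * θ (q ℕ.+ p) r                ≡⟨ cong (c r *_) (θ-shift p q r) ⟩
      c r * (θ p r * θ q (N ℕ.* p ℕ.+ r)) ≡⟨ cong (λ t → c r * (θ p r * θ q t)) (sym s≡Np+r) ⟩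
      c r * (θ p r * θ q s)              ≡⟨ sym (*-assoc (c r) (θ p r) (θ q s)) ⟩
      W s * θ q s                        ∎
      where
      r = s ℕ.% N
      p = s ℕ./ N
      swap : ∀ N q s → N ℕ.* q ℕ.+ s ≡ s ℕ.+ q ℕ.* N
      swap = ℕ-Solver.solve-∀
      remainder : (N ℕ.* q ℕ.+ s) ℕ.% N ≡ r
      remainder = trans (cong (ℕ._% N) (swap N q s)) ([m+kn]%n≡m%n s q N)
      quotient : (N ℕ.* q ℕ.+ s) ℕ./ N ≡ q ℕ.+ p
      quotient = begin
        (N ℕ.* q ℕ.+ s) ℕ./ N           ≡⟨ cong (ℕ._/ N) (swap N q s) ⟩
        (s ℕ.+ q ℕ.* N) ℕ./ N           ≡⟨ +-distrib-/-∣ʳ s (n∣m*n q) ⟩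
        p ℕ.+ q ℕ.* N ℕ./ N             ≡⟨ cong (p ℕ.+_) (m*n/n≡m q N) ⟩
        p ℕ.+ q                         ≡⟨ ℕ.+-comm p q ⟩
        q ℕ.+ p                         ∎
      s≡Np+r : s ≡ N ℕ.* p ℕ.+ r
      s≡Np+r = trans (m≡m%n+[m/n]*n s N) (reorder r p N)
        where
        reorder : ∀ r p N → r ℕ.+ p ℕ.* N ≡ N ℕ.* p ℕ.+ r
        reorder = ℕ-Solver.solve-∀

    odd-term : ∀ q s t w → s ℕ.+ 3 ℕ.* t ≡ 2 ℕ.* w →
               W s * W t ^ 3 * θ (2 ℕ.* q) w ≡ W (N ℕ.* q ℕ.+ s) * W (N ℕ.* q ℕ.+ t) ^ 3
    odd-term q s t w weight = begin
      W s * W t ^ 3 * θ (2 ℕ.* q) w          ≡⟨ cong (W s * W t ^ 3 *_) (sym (θ-odd q s t w weight)) ⟩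
      W s * W t ^ 3 * (θ q s * θ q t ^ 3)    ≡⟨ sym (shuffle (W s) (θ q s) (W t) (θ q t)) ⟩
      W s * θ q s * (W t * θ q t) ^ 3        ≡⟨ sym (cong₂ (λ x y → x * y ^ 3) (W-shift q s) (W-shift q t)) ⟩
      W (N ℕ.* q ℕ.+ s) * W (N ℕ.* q ℕ.+ t) ^ 3 ∎
      where
      shuffle : ∀ x a y b → x * a * (y * b) ^ 3 ≡ x * y ^ 3 * (a * b ^ 3)
      shuffle x a y b = trans (cong (x * a *_) (*-^ y b 3)) (interchange x a (y ^ 3) (b ^ 3))

    even-term : ∀ q s t u w → s ℕ.+ (t ℕ.+ 2 ℕ.* u) ≡ 2 ℕ.* w →
                W s * (W t * W u ^ 2) * θ (2 ℕ.* q) w ≡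
                W (N ℕ.* q ℕ.+ s) * (W (N ℕ.* q ℕ.+ t) * W (N ℕ.* q ℕ.+ u) ^ 2)
    even-term q s t u w weight = begin
      W s * (W t * W u ^ 2) * θ (2 ℕ.* q) w
        ≡⟨ cong (W s * (W t * W u ^ 2) *_) (sym (θ-even q s t u w weight)) ⟩
      W s * (W t * W u ^ 2) * (θ q s * (θ q t * θ q u ^ 2))
        ≡⟨ sym (shuffle (W s) (θ q s) (W t) (θ q t) (W u) (θ q u)) ⟩
      W s * θ q s * (W t * θ q t * (W u * θ q u) ^ 2)
        ≡⟨ sym (cong₂ (λ x y → x * y) (W-shift q s)
                  (cong₂ (λ x y → x * y ^ 2) (W-shift q t) (W-shift q u))) ⟩
      W (N ℕ.* q ℕ.+ s) * (W (N ℕ.* q ℕ.+ t) * W (N ℕ.* q ℕ.+ u) ^ 2) ∎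
      where
      regroup : ∀ x a y b Z C → x * a * (y * b * (Z * C)) ≡ x * (y * Z) * (a * (b * C))
      regroup = solve-∀
      shuffle : ∀ x a y b z c → x * a * (y * b * (z * c) ^ 2) ≡ x * (y * z ^ 2) * (a * (b * c ^ 2))
      shuffle x a y b z c = trans (cong (λ t → x * a * (y * b * t)) (*-^ z c 2)) (regroup x a y b (z ^ 2) (c ^ 2))

    odd-transfer : ∀ q r → OddRel W (ℕ.suc r) → OddRel W (N ℕ.* q ℕ.+ ℕ.suc r)
    odd-transfer q r base = begin
      W (2 ℕ.* m ℕ.+ 1)
        ≡⟨ cong W (double N q r) ⟩
      W (N ℕ.* (2 ℕ.* q) ℕ.+ w)
        ≡⟨ W-shift (2 ℕ.* q) w ⟩
      W w * θ (2 ℕ.* q) w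
        ≡⟨ cong (_* θ (2 ℕ.* q) w) base ⟩
      (W (ℕ.suc r ℕ.+ 2) * W (ℕ.suc r) ^ 3 - W r * W (ℕ.suc r ℕ.+ 1) ^ 3) * θ (2 ℕ.* q) w
        ≡⟨ *-distribʳ-- (W (ℕ.suc r ℕ.+ 2) * W (ℕ.suc r) ^ 3) (W r * W (ℕ.suc r ℕ.+ 1) ^ 3) _ ⟩
      W (ℕ.suc r ℕ.+ 2) * W (ℕ.suc r) ^ 3 * θ (2 ℕ.* q) w - W r * W (ℕ.suc r ℕ.+ 1) ^ 3 * θ (2 ℕ.* q) w
        ≡⟨ cong₂ _-_ (odd-term q _ _ w (weight₁ r)) (odd-term q _ _ w (weight₂ r)) ⟩
      W (N ℕ.* q ℕ.+ (ℕ.suc r ℕ.+ 2)) * W m ^ 3 - W (N ℕ.* q ℕ.+ r) * W (N ℕ.* q ℕ.+ (ℕ.suc r ℕ.+ 1)) ^ 3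
        ≡⟨ sym (cong₂ _-_ (cong (λ i → W i * W m ^ 3) (ℕ.+-assoc (N ℕ.* q) (ℕ.suc r) 2))
                          (cong₂ (λ i j → W i * W j ^ 3) (ℕ.+-∸-assoc (N ℕ.* q) (ℕ.s≤s ℕ.z≤n))
                                                          (ℕ.+-assoc (N ℕ.* q) (ℕ.suc r) 1))) ⟩
      W (m ℕ.+ 2) * W m ^ 3 - W (m ℕ.∸ 1) * W (m ℕ.+ 1) ^ 3 ∎
      where
      m = N ℕ.* q ℕ.+ ℕ.suc r
      w = 2 ℕ.* ℕ.suc r ℕ.+ 1
      double : ∀ N q r → 2 ℕ.* (N ℕ.* q ℕ.+ ℕ.suc r) ℕ.+ 1 ≡ N ℕ.* (2 ℕ.* q) ℕ.+ (2 ℕ.* ℕ.suc r ℕ.+ 1)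
      double = ℕ-Solver.solve-∀
      weight₁ : ∀ r → ℕ.suc r ℕ.+ 2 ℕ.+ 3 ℕ.* ℕ.suc r ≡ 2 ℕ.* (2 ℕ.* ℕ.suc r ℕ.+ 1)
      weight₁ = ℕ-Solver.solve-∀
      weight₂ : ∀ r → r ℕ.+ 3 ℕ.* (ℕ.suc r ℕ.+ 1) ≡ 2 ℕ.* (2 ℕ.* ℕ.suc r ℕ.+ 1)
      weight₂ = ℕ-Solver.solve-∀

    even-transfer : ∀ q r → EvenRel W (2 ℕ.+ r) → EvenRel W (N ℕ.* q ℕ.+ (2 ℕ.+ r))
    even-transfer q r base = begin
      W 2 * W (2 ℕ.* m)
        ≡⟨ cong (λ i → W 2 * W i) (double N q r) ⟩
      W 2 * W (N ℕ.* (2 ℕ.* q) ℕ.+ w)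
        ≡⟨ trans (cong (W 2 *_) (W-shift (2 ℕ.* q) w)) (sym (*-assoc (W 2) (W w) (θ (2 ℕ.* q) w))) ⟩
      W 2 * W w * θ (2 ℕ.* q) w
        ≡⟨ cong (_* θ (2 ℕ.* q) w) base ⟩
      W k * (W (k ℕ.+ 2) * W (ℕ.suc r) ^ 2 - W r * W (k ℕ.+ 1) ^ 2) * θ (2 ℕ.* q) w
        ≡⟨ trans (cong (_* θ (2 ℕ.* q) w) (*-distribˡ-- (W k) X Y)) (*-distribʳ-- (W k * X) (W k * Y) _) ⟩
      W k * (W (k ℕ.+ 2) * W (ℕ.suc r) ^ 2) * θ (2 ℕ.* q) w - W k * (W r * W (k ℕ.+ 1) ^ 2) * θ (2 ℕ.* q) w
        ≡⟨ cong₂ _-_ (even-term q _ _ _ w (weight₁ r)) (even-term q _ _ _ w (weight₂ r)) ⟩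
      W m * (W (N ℕ.* q ℕ.+ (k ℕ.+ 2)) * W (N ℕ.* q ℕ.+ ℕ.suc r) ^ 2)
        - W m * (W (N ℕ.* q ℕ.+ r) * W (N ℕ.* q ℕ.+ (k ℕ.+ 1)) ^ 2)
        ≡⟨ sym (*-distribˡ-- (W m) _ _) ⟩
      W m * (W (N ℕ.* q ℕ.+ (k ℕ.+ 2)) * W (N ℕ.* q ℕ.+ ℕ.suc r) ^ 2
               - W (N ℕ.* q ℕ.+ r) * W (N ℕ.* q ℕ.+ (k ℕ.+ 1)) ^ 2)
        ≡⟨ sym (cong (W m *_) (cong₂ _-_
              (cong₂ (λ i j → W i * W j ^ 2) (ℕ.+-assoc (N ℕ.* q) k 2) (ℕ.+-∸-assoc (N ℕ.* q) (ℕ.s≤s ℕ.z≤n)))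
              (cong₂ (λ i j → W i * W j ^ 2) (ℕ.+-∸-assoc (N ℕ.* q) (ℕ.s≤s (ℕ.s≤s ℕ.z≤n))) (ℕ.+-assoc (N ℕ.* q) k 1)))) ⟩
      W m * (W (m ℕ.+ 2) * W (m ℕ.∸ 1) ^ 2 - W (m ℕ.∸ 2) * W (m ℕ.+ 1) ^ 2) ∎
      where
      k = 2 ℕ.+ r
      m = N ℕ.* q ℕ.+ k
      w = 2 ℕ.* k
      X = W (k ℕ.+ 2) * W (ℕ.suc r) ^ 2
      Y = W r * W (k ℕ.+ 1) ^ 2
      double : ∀ N q r → 2 ℕ.* (N ℕ.* q ℕ.+ (2 ℕ.+ r)) ≡ N ℕ.* (2 ℕ.* q) ℕ.+ 2 ℕ.* (2 ℕ.+ r)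
      double = ℕ-Solver.solve-∀
      weight₁ : ∀ r → 2 ℕ.+ r ℕ.+ (2 ℕ.+ r ℕ.+ 2 ℕ.+ 2 ℕ.* ℕ.suc r) ≡ 2 ℕ.* (2 ℕ.* (2 ℕ.+ r))
      weight₁ = ℕ-Solver.solve-∀
      weight₂ : ∀ r → 2 ℕ.+ r ℕ.+ (r ℕ.+ 2 ℕ.* (2 ℕ.+ r ℕ.+ 1)) ≡ 2 ℕ.* (2 ℕ.* (2 ℕ.+ r))
      weight₂ = ℕ-Solver.solve-∀

    odd-everywhere : (∀ j → j ℕ.< N → OddRel W (ℕ.suc j)) → ∀ m → OddRel W (ℕ.suc m)
    odd-everywhere window m =
      subst (OddRel W) (sym split) (odd-transfer (m ℕ./ N) (m ℕ.% N) (window (m ℕ.% N) (m%n<n m N)))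
      where
      reorder : ∀ r q N → ℕ.suc (r ℕ.+ q ℕ.* N) ≡ N ℕ.* q ℕ.+ ℕ.suc r
      reorder = ℕ-Solver.solve-∀
      split : ℕ.suc m ≡ N ℕ.* (m ℕ./ N) ℕ.+ ℕ.suc (m ℕ.% N)
      split = trans (cong ℕ.suc (m≡m%n+[m/n]*n m N)) (reorder (m ℕ.% N) (m ℕ./ N) N)

    even-everywhere : (∀ j → j ℕ.< N → EvenRel W (2 ℕ.+ j)) → ∀ m → EvenRel W (2 ℕ.+ m)
    even-everywhere window m =
      subst (EvenRel W) (sym split) (even-transfer (m ℕ./ N) (m ℕ.% N) (window (m ℕ.% N) (m%n<n m N)))
      where
      reorder : ∀ r q N → 2 ℕ.+ (r ℕ.+ q ℕ.* N) ≡ N ℕ.* q ℕ.+ (2 ℕ.+ r)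
      reorder = ℕ-Solver.solve-∀
      split : 2 ℕ.+ m ≡ N ℕ.* (m ℕ./ N) ℕ.+ (2 ℕ.+ m ℕ.% N)
      split = trans (cong (2 ℕ.+_) (m≡m%n+[m/n]*n m N)) (reorder (m ℕ.% N) (m ℕ./ N) N)

data Parity : ℕ → Set where
  even : ∀ m → Parity (2 ℕ.* m)
  odd  : ∀ m → Parity (2 ℕ.* m ℕ.+ 1)

parity : ∀ n → Parity n
parity ℕ.zero    = even 0
parity (ℕ.suc n) with parity n
... | even m = subst Parity (ℕ.+-comm (2 ℕ.* m) 1) (odd m)
... | odd m  = subst Parity (two-suc m) (even (ℕ.suc m))
  where
  two-suc : ∀ m → 2 ℕ.* ℕ.suc m ≡ ℕ.suc (2 ℕ.* m ℕ.+ 1)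
  two-suc = ℕ-Solver.solve-∀

odd-rhs-cong : ∀ {h g : ℕ → ℤ} m → (∀ {i} → i ℕ.≤ m ℕ.+ 2 → h i ≡ g i) →
  h (m ℕ.+ 2) * h m ^ 3 - h (m ℕ.∸ 1) * h (m ℕ.+ 1) ^ 3 ≡
  g (m ℕ.+ 2) * g m ^ 3 - g (m ℕ.∸ 1) * g (m ℕ.+ 1) ^ 3
odd-rhs-cong m agree = cong₂ _-_
  (cong₂ (λ a b → a * b ^ 3) (agree ℕ.≤-refl) (agree (ℕ.m≤m+n m 2)))
  (cong₂ (λ a b → a * b ^ 3) (agree (ℕ.≤-trans (ℕ.m∸n≤m m 1) (ℕ.m≤m+n m 2)))
                             (agree (ℕ.+-monoʳ-≤ m (ℕ.s≤s ℕ.z≤n))))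

even-rhs-cong : ∀ {h g : ℕ → ℤ} m → (∀ {i} → i ℕ.≤ m ℕ.+ 2 → h i ≡ g i) →
  h m * (h (m ℕ.+ 2) * h (m ℕ.∸ 1) ^ 2 - h (m ℕ.∸ 2) * h (m ℕ.+ 1) ^ 2) ≡
  g m * (g (m ℕ.+ 2) * g (m ℕ.∸ 1) ^ 2 - g (m ℕ.∸ 2) * g (m ℕ.+ 1) ^ 2)
even-rhs-cong m agree = cong₂ _*_ (agree (ℕ.m≤m+n m 2)) (cong₂ _-_
  (cong₂ (λ a b → a * b ^ 2) (agree ℕ.≤-refl) (agree (ℕ.≤-trans (ℕ.m∸n≤m m 1) (ℕ.m≤m+n m 2))))
  (cong₂ (λ a b → a * b ^ 2) (agree (ℕ.≤-trans (ℕ.m∸n≤m m 2) (ℕ.m≤m+n m 2)))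
                             (agree (ℕ.+-monoʳ-≤ m (ℕ.s≤s ℕ.z≤n)))))

-- A sequence satisfying IsHSeq is determined by α as soon as h 2 ≠ 0: by strong
-- induction, the recurrences express h n through indices ≤ n/2 + 2 < n for n ≥ 5,
-- the even one after cancelling the factor h 2.
hseq-unique : ∀ {α h g} → IsHSeq α h → IsHSeq α g → h 2 ≢ 0ℤ → ∀ n → h n ≡ g n
hseq-unique {α} {h} {g} H G h₂≢0 = <-rec (λ n → h n ≡ g n) agree
  where
  module H = IsHSeq H
  module G = IsHSeq G
  h₂≡g₂ : h 2 ≡ g 2
  h₂≡g₂ = trans H.h2 (sym G.h2)
  upto : ∀ {n b} → (∀ {k} → k ℕ.< n → h k ≡ g k) → b ℕ.< n → ∀ {i} → i ℕ.≤ b → h i ≡ g i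
  upto ih b<n i≤b = ih (ℕ.≤-<-trans i≤b b<n)
  odd-bound : ∀ j → 2 ℕ.+ j ℕ.+ 2 ℕ.< 2 ℕ.* (2 ℕ.+ j) ℕ.+ 1
  odd-bound j = subst (2 ℕ.+ j ℕ.+ 2 ℕ.<_) (gap j) (ℕ.s≤s (ℕ.m≤m+n (2 ℕ.+ j ℕ.+ 2) j))
    where
    gap : ∀ j → ℕ.suc (2 ℕ.+ j ℕ.+ 2 ℕ.+ j) ≡ 2 ℕ.* (2 ℕ.+ j) ℕ.+ 1
    gap = ℕ-Solver.solve-∀
  even-bound : ∀ j → 3 ℕ.+ j ℕ.+ 2 ℕ.< 2 ℕ.* (3 ℕ.+ j)
  even-bound j = subst (3 ℕ.+ j ℕ.+ 2 ℕ.<_) (gap j) (ℕ.s≤s (ℕ.m≤m+n (3 ℕ.+ j ℕ.+ 2) j))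
    where
    gap : ∀ j → ℕ.suc (3 ℕ.+ j ℕ.+ 2 ℕ.+ j) ≡ 2 ℕ.* (3 ℕ.+ j)
    gap = ℕ-Solver.solve-∀
  agree : ∀ n → (∀ {k} → k ℕ.< n → h k ≡ g k) → h n ≡ g n
  agree n ih with parity n
  ... | even 0 = trans H.h0 (sym G.h0)
  ... | even 1 = h₂≡g₂
  ... | even 2 = trans H.h4 (sym G.h4)
  ... | even (ℕ.suc (ℕ.suc (ℕ.suc j))) = *-cancelˡ-≡ (h 2) _ _ (begin
    h 2 * h (2 ℕ.* m)   ≡⟨ H.even m (ℕ.s≤s (ℕ.s≤s (ℕ.s≤s ℕ.z≤n))) ⟩
    _                   ≡⟨ even-rhs-cong m (upto ih (even-bound j)) ⟩
    _                   ≡⟨ sym (G.even m (ℕ.s≤s (ℕ.s≤s (ℕ.s≤s ℕ.z≤n)))) ⟩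
    g 2 * g (2 ℕ.* m)   ≡⟨ cong (_* g (2 ℕ.* m)) (sym h₂≡g₂) ⟩
    h 2 * g (2 ℕ.* m)   ∎)
    where
    m = 3 ℕ.+ j
    instance
      h₂-nonZero : NonZero (h 2)
      h₂-nonZero = ≢-nonZero h₂≢0
  ... | odd 0 = trans H.h1 (sym G.h1)
  ... | odd 1 = trans H.h3 (sym G.h3)
  ... | odd (ℕ.suc (ℕ.suc j)) = begin
    h (2 ℕ.* m ℕ.+ 1)   ≡⟨ H.odd m (ℕ.s≤s (ℕ.s≤s ℕ.z≤n)) ⟩
    _                   ≡⟨ odd-rhs-cong m (upto ih (odd-bound j)) ⟩
    _                   ≡⟨ sym (G.odd m (ℕ.s≤s (ℕ.s≤s ℕ.z≤n))) ⟩
    g (2 ℕ.* m ℕ.+ 1)   ∎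
    where
    m = 2 ℕ.+ j

-- Exponent vectors ⟨ s , a , b , c ⟩ of signed monomials (−1)ˢ αᵃ (α−1)ᵇ γᶜ.
record Exp : Set where
  constructor ⟨_,_,_,_⟩
  field
    sgn pα pβ pγ : ℕ

infixl 6 _⊕_ _⊖_
infixr 7 _⊙_

_⊕_ : Exp → Exp → Exp
⟨ s , a , b , c ⟩ ⊕ ⟨ s′ , a′ , b′ , c′ ⟩ = ⟨ s ℕ.+ s′ , a ℕ.+ a′ , b ℕ.+ b′ , c ℕ.+ c′ ⟩

_⊖_ : Exp → Exp → Exp
⟨ s , a , b , c ⟩ ⊖ ⟨ s′ , a′ , b′ , c′ ⟩ = ⟨ s ℕ.∸ s′ , a ℕ.∸ a′ , b ℕ.∸ b′ , c ℕ.∸ c′ ⟩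

_⊙_ : ℕ → Exp → Exp
n ⊙ ⟨ s , a , b , c ⟩ = ⟨ n ℕ.* s , n ℕ.* a , n ℕ.* b , n ℕ.* c ⟩

-- Componentwise ≤, as a product of T's: for numerals it reduces to ⊤, so the
-- proof is filled in automatically.
_≤ₑ_ : Exp → Exp → Set
⟨ s , a , b , c ⟩ ≤ₑ ⟨ s′ , a′ , b′ , c′ ⟩ =
  T (s ℕ.≤ᵇ s′) × T (a ℕ.≤ᵇ a′) × T (b ℕ.≤ᵇ b′) × T (c ℕ.≤ᵇ c′)

⊕-⊖ : ∀ g e → g ≤ₑ e → g ⊕ (e ⊖ g) ≡ e
⊕-⊖ ⟨ s , a , b , c ⟩ ⟨ s′ , a′ , b′ , c′ ⟩ (s≤ , a≤ , b≤ , c≤) =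
  cong₄ (restore s s′ s≤) (restore a a′ a≤) (restore b b′ b≤) (restore c c′ c≤)
  where
  restore : ∀ m n → T (m ℕ.≤ᵇ n) → m ℕ.+ (n ℕ.∸ m) ≡ n
  restore m n m≤n = ℕ.m+[n∸m]≡n (ℕ.≤ᵇ⇒≤ m n m≤n)
  cong₄ : ∀ {s a b c s′ a′ b′ c′} → s ≡ s′ → a ≡ a′ → b ≡ b′ → c ≡ c′ →
          ⟨ s , a , b , c ⟩ ≡ ⟨ s′ , a′ , b′ , c′ ⟩
  cong₄ refl refl refl refl = refl

-- A monomial exponent or the zero polynomial.
Term : Set
Term = Maybe Exp

infixl 7 _·_
_·_ : Term → Term → Term
just e · just f = just (e ⊕ f)
_      · _      = nothing

_^^_ : Term → ℕ → Term
t ^^ ℕ.zero  = just ⟨ 0 , 0 , 0 , 0 ⟩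
t ^^ ℕ.suc n = t · t ^^ n

_÷_ : Term → Exp → Term
just e  ÷ g = just (e ⊖ g)
nothing ÷ g = nothing

_divides_ : Exp → Term → Set
g divides just e  = g ≤ₑ e
g divides nothing = ⊤

common : Term → Term → Exp
common (just ⟨ _ , a , b , c ⟩) (just ⟨ _ , a′ , b′ , c′ ⟩) = ⟨ 0 , a ℕ.⊓ a′ , b ℕ.⊓ b′ , c ℕ.⊓ c′ ⟩
common (just ⟨ _ , a , b , c ⟩) nothing                     = ⟨ 0 , a , b , c ⟩
common nothing                  (just ⟨ _ , a , b , c ⟩)    = ⟨ 0 , a , b , c ⟩
common nothing                  nothing                     = ⟨ 0 , 0 , 0 , 0 ⟩

-- γ has no integer roots: γ α = 0 would give α (1 − α) = 1.
γ≢0 : ∀ α → γ α ≢ 0ℤ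
γ≢0 α γ≡0 = no-unit-product α (trans (rewrite-γ α) (cong (λ g → 1ℤ - g) γ≡0))
  where
  -- α (1 − α) = 1 − γ α, with γ unfolded for the solver
  rewrite-γ : ∀ x → x * (1ℤ - x) ≡ 1ℤ - (x * (x * 1ℤ) - x + 1ℤ)
  rewrite-γ = solve-∀
  unit-abs : ∀ x → x * (1ℤ - x) ≡ 1ℤ → ∣ x ∣ ≡ 1
  unit-abs x e = ℕ.m*n≡1⇒m≡1 ∣ x ∣ ∣ 1ℤ - x ∣ (trans (sym (abs-* x (1ℤ - x))) (cong ∣_∣ e))
  no-unit-product : ∀ x → x * (1ℤ - x) ≢ 1ℤ
  no-unit-product (+ 0)                     ()
  no-unit-product (+ 1)                     ()
  no-unit-product (+ ℕ.suc (ℕ.suc n)) e with unit-abs (+ ℕ.suc (ℕ.suc n)) e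
  ... | ()
  no-unit-product -[1+ 0 ]                  ()
  no-unit-product -[1+ ℕ.suc n ]      e with unit-abs -[1+ ℕ.suc n ] e
  ... | ()

module Monomials (α : ℤ) where

  mono : Exp → ℤ
  mono ⟨ s , a , b , c ⟩ = -1ℤ ^ s * α ^ a * (α - 1ℤ) ^ b * γ α ^ c

  mono-⊕ : ∀ e f → mono (e ⊕ f) ≡ mono e * mono f
  mono-⊕ ⟨ s , a , b , c ⟩ ⟨ s′ , a′ , b′ , c′ ⟩ = begin
    -1ℤ ^ (s ℕ.+ s′) * α ^ (a ℕ.+ a′) * (α - 1ℤ) ^ (b ℕ.+ b′) * γ α ^ (c ℕ.+ c′)
      ≡⟨ cong₂ _*_ (cong₂ _*_ (cong₂ _*_ (^-distribˡ-+-* -1ℤ s s′) (^-distribˡ-+-* α a a′))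
                              (^-distribˡ-+-* (α - 1ℤ) b b′)) (^-distribˡ-+-* (γ α) c c′) ⟩
    -1ℤ ^ s * -1ℤ ^ s′ * (α ^ a * α ^ a′) * ((α - 1ℤ) ^ b * (α - 1ℤ) ^ b′) * (γ α ^ c * γ α ^ c′)
      ≡⟨ regroup (-1ℤ ^ s) (α ^ a) ((α - 1ℤ) ^ b) (γ α ^ c) (-1ℤ ^ s′) (α ^ a′) ((α - 1ℤ) ^ b′) (γ α ^ c′) ⟩
    mono ⟨ s , a , b , c ⟩ * mono ⟨ s′ , a′ , b′ , c′ ⟩ ∎
    where
    regroup : ∀ s a b c s′ a′ b′ c′ →
      s * s′ * (a * a′) * (b * b′) * (c * c′) ≡ s * a * b * c * (s′ * a′ * b′ * c′)
    regroup = solve-∀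

  mono-⊙ : ∀ n e → mono (n ⊙ e) ≡ mono e ^ n
  mono-⊙ ℕ.zero    e = refl
  mono-⊙ (ℕ.suc n) e = trans (mono-⊕ e (n ⊙ e)) (cong (mono e *_) (mono-⊙ n e))

  mono-sign : ∀ s a b c → mono ⟨ 2 ℕ.+ s , a , b , c ⟩ ≡ mono ⟨ s , a , b , c ⟩
  mono-sign s a b c = cong (λ x → x * α ^ a * (α - 1ℤ) ^ b * γ α ^ c) (neg-neg (-1ℤ ^ s))
    where
    neg-neg : ∀ x → -1ℤ * (-1ℤ * x) ≡ x
    neg-neg = solve-∀

  mono≢0 : α ≢ 0ℤ → α ≢ 1ℤ → ∀ e → mono e ≢ 0ℤ
  mono≢0 α≢0 α≢1 ⟨ s , a , b , c ⟩ =
    *-≢0 (*-≢0 (*-≢0 (^-≢0 s (λ ())) (^-≢0 a α≢0)) (^-≢0 b α-1≢0)) (^-≢0 c (γ≢0 α))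
    where
    shift : ∀ x → x ≡ x - 1ℤ + 1ℤ
    shift = solve-∀
    α-1≢0 : α - 1ℤ ≢ 0ℤ
    α-1≢0 α-1≡0 = α≢1 (trans (shift α) (cong (_+ 1ℤ) α-1≡0))

  ⟦_⟧ : Term → ℤ
  ⟦ just e  ⟧ = mono e
  ⟦ nothing ⟧ = 0ℤ

  ⟦·⟧ : ∀ s t → ⟦ s · t ⟧ ≡ ⟦ s ⟧ * ⟦ t ⟧
  ⟦·⟧ (just e) (just f) = mono-⊕ e f
  ⟦·⟧ (just e) nothing  = sym (*-zeroʳ (mono e))
  ⟦·⟧ nothing  t        = refl

  ⟦^^⟧ : ∀ t n → ⟦ t ^^ n ⟧ ≡ ⟦ t ⟧ ^ n
  ⟦^^⟧ t ℕ.zero    = refl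
  ⟦^^⟧ t (ℕ.suc n) = trans (⟦·⟧ t (t ^^ n)) (cong (⟦ t ⟧ *_) (⟦^^⟧ t n))

  factor : ∀ g t → g divides t → ⟦ t ⟧ ≡ mono g * ⟦ t ÷ g ⟧
  factor g (just e) g≤e = trans (cong mono (sym (⊕-⊖ g e g≤e))) (mono-⊕ g (e ⊖ g))
  factor g nothing  _   = sym (*-zeroʳ (mono g))

  -- An identity t₀ = t₁ − t₂ between terms follows from the same identity
  -- between the quotients by their common monomial factor.
  Quotient : Term → Term → Term → Set
  Quotient t₀ t₁ t₂ = ⟦ t₁ ÷ g ⟧ - ⟦ t₂ ÷ g ⟧ ≡ ⟦ t₀ ÷ g ⟧
    where g = common t₁ t₂

  Divisible : Term → Term → Term → Set
  Divisible t₀ t₁ t₂ = g divides t₀ × g divides t₁ × g divides t₂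
    where g = common t₁ t₂

  by-quotient : ∀ t₀ t₁ t₂ → Divisible t₀ t₁ t₂ → Quotient t₀ t₁ t₂ → ⟦ t₀ ⟧ ≡ ⟦ t₁ ⟧ - ⟦ t₂ ⟧
  by-quotient t₀ t₁ t₂ (g∣t₀ , g∣t₁ , g∣t₂) quotient = begin
    ⟦ t₀ ⟧                                     ≡⟨ factor g t₀ g∣t₀ ⟩
    mono g * ⟦ t₀ ÷ g ⟧                        ≡⟨ cong (mono g *_) (sym quotient) ⟩
    mono g * (⟦ t₁ ÷ g ⟧ - ⟦ t₂ ÷ g ⟧)         ≡⟨ *-distribˡ-- (mono g) _ _ ⟩
    mono g * ⟦ t₁ ÷ g ⟧ - mono g * ⟦ t₂ ÷ g ⟧  ≡⟨ sym (cong₂ _-_ (factor g t₁ g∣t₁) (factor g t₂ g∣t₂)) ⟩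
    ⟦ t₁ ⟧ - ⟦ t₂ ⟧                            ∎
    where g = common t₁ t₂

-- After the common monomial
-- factor is removed from the three terms of a recurrence, what remains is one of
-- the following relations between 1, α, α − 1 and γ = α² − α + 1, written out
-- as the signed monomials of Monomials.mono unfold (powers as products ending
-- in 1, γ expanded) so that the ring solver can read them.

-- γ − 1 = α (α − 1)
quotient-γ-1 : ∀ x → -1ℤ - -1ℤ * ((x * (x * 1ℤ) - x + 1ℤ) * 1ℤ) ≡ 1ℤ * (x * 1ℤ) * ((x - 1ℤ) * 1ℤ) * 1ℤ
quotient-γ-1 = solve-∀

-- 1 − γ = −α (α − 1)
quotient-1-γ : ∀ x → -1ℤ * ((x * (x * 1ℤ) - x + 1ℤ) * 1ℤ) - -1ℤ ≡ -1ℤ * (x * 1ℤ) * ((x - 1ℤ) * 1ℤ) * 1ℤ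
quotient-1-γ = solve-∀

-- γ − α = (α − 1)²
quotient-γ-α : ∀ x → -1ℤ * (x * 1ℤ) * 1ℤ * 1ℤ - -1ℤ * ((x * (x * 1ℤ) - x + 1ℤ) * 1ℤ) ≡
                      1ℤ * ((x - 1ℤ) * ((x - 1ℤ) * 1ℤ)) * 1ℤ
quotient-γ-α = solve-∀

-- α − γ = −(α − 1)²
quotient-α-γ : ∀ x → -1ℤ * ((x * (x * 1ℤ) - x + 1ℤ) * 1ℤ) - -1ℤ * (x * 1ℤ) * 1ℤ * 1ℤ ≡
                      -1ℤ * ((x - 1ℤ) * ((x - 1ℤ) * 1ℤ)) * 1ℤ
quotient-α-γ = solve-∀

-- −1 + α = α − 1
quotient-α-1 : ∀ x → -1ℤ - -1ℤ * (x * 1ℤ) * 1ℤ * 1ℤ ≡ 1ℤ * ((x - 1ℤ) * 1ℤ) * 1ℤ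
quotient-α-1 = solve-∀

-- 1 − α = −(α − 1)
quotient-1-α : ∀ x → -1ℤ * (x * 1ℤ) * 1ℤ * 1ℤ - -1ℤ ≡ -1ℤ * ((x - 1ℤ) * 1ℤ) * 1ℤ
quotient-1-α = solve-∀

module Order9 (α : ℤ) where
  open Monomials α

  residue : ℕ → Term
  residue 1 = just ⟨ 0 ,  0 ,  0 ,  0 ⟩
  residue 2 = just ⟨ 1 ,  2 ,  1 ,  1 ⟩
  residue 3 = just ⟨ 1 ,  6 ,  3 ,  3 ⟩
  residue 4 = just ⟨ 0 , 12 ,  6 ,  5 ⟩
  residue 5 = just ⟨ 0 , 19 , 10 ,  8 ⟩
  residue 6 = just ⟨ 1 , 27 , 15 , 12 ⟩
  residue 7 = just ⟨ 1 , 37 , 21 , 16 ⟩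
  residue 8 = just ⟨ 0 , 49 , 28 , 21 ⟩
  residue _ = nothing

  expA expB : Exp
  expA = ⟨ 1 , 63 , 36 , 27 ⟩
  expB = ⟨ 0 , 14 ,  8 ,  6 ⟩

  A²≡B⁹ : mono expA ^ 2 ≡ mono expB ^ 9
  A²≡B⁹ = trans (sym (mono-⊙ 2 expA)) (trans (mono-sign 0 126 72 54) (mono-⊙ 9 expB))

  open QuasiPeriodic 9 (mono expA) (mono expB) A²≡B⁹ public
  open Extension (λ r → ⟦ residue r ⟧) public

  shape : ℕ → Term
  shape n = residue (n ℕ.% 9) · just ((q ℕ.* q) ⊙ expA ⊕ (q ℕ.* (n ℕ.% 9)) ⊙ expB)
    where q = n ℕ./ 9

  pw-mono : ∀ a b → pw a b ≡ mono (a ⊙ expA ⊕ b ⊙ expB)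
  pw-mono a b = sym (trans (mono-⊕ (a ⊙ expA) (b ⊙ expB)) (cong₂ _*_ (mono-⊙ a expA) (mono-⊙ b expB)))

  W-shape : ∀ n → W n ≡ ⟦ shape n ⟧
  W-shape n = trans (cong (⟦ residue r ⟧ *_) (pw-mono (q ℕ.* q) (q ℕ.* r)))
                    (sym (⟦·⟧ (residue r) (just ((q ℕ.* q) ⊙ expA ⊕ (q ℕ.* r) ⊙ expB))))
    where
    q = n ℕ./ 9
    r = n ℕ.% 9

  W-· : ∀ i t → W i * ⟦ t ⟧ ≡ ⟦ shape i · t ⟧
  W-· i t = trans (cong (_* ⟦ t ⟧) (W-shape i)) (sym (⟦·⟧ (shape i) t))

  W-^ : ∀ j n → W j ^ n ≡ ⟦ shape j ^^ n ⟧
  W-^ j n = trans (cong (_^ n) (W-shape j)) (sym (⟦^^⟧ (shape j) n))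

  odd₀ odd₁ odd₂ even₀ even₁ even₂ : ℕ → Term
  odd₀ r = shape (2 ℕ.* r ℕ.+ 1)
  odd₁ r = shape (r ℕ.+ 2) · shape r ^^ 3
  odd₂ r = shape (r ℕ.∸ 1) · shape (r ℕ.+ 1) ^^ 3
  even₀ r = shape 2 · shape (2 ℕ.* r)
  even₁ r = shape r · (shape (r ℕ.+ 2) · shape (r ℕ.∸ 1) ^^ 2)
  even₂ r = shape r · (shape (r ℕ.∸ 2) · shape (r ℕ.+ 1) ^^ 2)

  odd-base : ∀ r → {Divisible (odd₀ r) (odd₁ r) (odd₂ r)} →
             Quotient (odd₀ r) (odd₁ r) (odd₂ r) → OddRel W r
  odd-base r {divisible} quotient = begin
    W (2 ℕ.* r ℕ.+ 1)                 ≡⟨ W-shape (2 ℕ.* r ℕ.+ 1) ⟩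
    ⟦ odd₀ r ⟧                        ≡⟨ by-quotient (odd₀ r) (odd₁ r) (odd₂ r) divisible quotient ⟩
    ⟦ odd₁ r ⟧ - ⟦ odd₂ r ⟧           ≡⟨ sym (cong₂ _-_ (term (r ℕ.+ 2) r) (term (r ℕ.∸ 1) (r ℕ.+ 1))) ⟩
    W (r ℕ.+ 2) * W r ^ 3 - W (r ℕ.∸ 1) * W (r ℕ.+ 1) ^ 3 ∎
    where
    term : ∀ i j → W i * W j ^ 3 ≡ ⟦ shape i · shape j ^^ 3 ⟧
    term i j = trans (cong (W i *_) (W-^ j 3)) (W-· i (shape j ^^ 3))

  even-base : ∀ r → {Divisible (even₀ r) (even₁ r) (even₂ r)} →
              Quotient (even₀ r) (even₁ r) (even₂ r) → EvenRel W r
  even-base r {divisible} quotient = begin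
    W 2 * W (2 ℕ.* r)                 ≡⟨ trans (cong (W 2 *_) (W-shape (2 ℕ.* r))) (W-· 2 (shape (2 ℕ.* r))) ⟩
    ⟦ even₀ r ⟧                       ≡⟨ by-quotient (even₀ r) (even₁ r) (even₂ r) divisible quotient ⟩
    ⟦ even₁ r ⟧ - ⟦ even₂ r ⟧         ≡⟨ sym (cong₂ _-_ (term (r ℕ.+ 2) (r ℕ.∸ 1)) (term (r ℕ.∸ 2) (r ℕ.+ 1))) ⟩
    W r * (W (r ℕ.+ 2) * W (r ℕ.∸ 1) ^ 2) - W r * (W (r ℕ.∸ 2) * W (r ℕ.+ 1) ^ 2)
      ≡⟨ sym (*-distribˡ-- (W r) (W (r ℕ.+ 2) * W (r ℕ.∸ 1) ^ 2) (W (r ℕ.∸ 2) * W (r ℕ.+ 1) ^ 2)) ⟩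
    W r * (W (r ℕ.+ 2) * W (r ℕ.∸ 1) ^ 2 - W (r ℕ.∸ 2) * W (r ℕ.+ 1) ^ 2) ∎
    where
    term : ∀ i j → W r * (W i * W j ^ 2) ≡ ⟦ shape r · (shape i · shape j ^^ 2) ⟧
    term i j = trans (cong (λ x → W r * (W i * x)) (W-^ j 2))
                     (trans (cong (W r *_) (W-· i (shape j ^^ 2))) (W-· r (shape i · shape j ^^ 2)))

  -- The windows r = 1, …, 9 (odd) and r = 2, …, 10 (even).  Where a term vanishes
  -- or all quotients are constants, the quotient relation holds by computation.
  odd-window : ∀ j → j ℕ.< 9 → OddRel W (ℕ.suc j)
  odd-window 0 _ = odd-base 1 refl
  odd-window 1 _ = odd-base 2 (quotient-γ-1 α)
  odd-window 2 _ = odd-base 3 (quotient-α-γ α)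
  odd-window 3 _ = odd-base 4 refl
  odd-window 4 _ = odd-base 5 (quotient-γ-α α)
  odd-window 5 _ = odd-base 6 (quotient-1-γ α)
  odd-window 6 _ = odd-base 7 refl
  odd-window 7 _ = odd-base 8 refl
  odd-window 8 _ = odd-base 9 refl
  odd-window (ℕ.suc (ℕ.suc (ℕ.suc (ℕ.suc (ℕ.suc (ℕ.suc (ℕ.suc (ℕ.suc (ℕ.suc _)))))))))
    (ℕ.s≤s (ℕ.s≤s (ℕ.s≤s (ℕ.s≤s (ℕ.s≤s (ℕ.s≤s (ℕ.s≤s (ℕ.s≤s (ℕ.s≤s ())))))))))

  even-window : ∀ j → j ℕ.< 9 → EvenRel W (2 ℕ.+ j)
  even-window 0 _ = even-base 2 refl
  even-window 1 _ = even-base 3 (quotient-α-1 α)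
  even-window 2 _ = even-base 4 (quotient-α-γ α)
  even-window 3 _ = even-base 5 (quotient-γ-α α)
  even-window 4 _ = even-base 6 (quotient-1-α α)
  even-window 5 _ = even-base 7 refl
  even-window 6 _ = even-base 8 refl
  even-window 7 _ = even-base 9 refl
  even-window 8 _ = even-base 10 refl
  even-window (ℕ.suc (ℕ.suc (ℕ.suc (ℕ.suc (ℕ.suc (ℕ.suc (ℕ.suc (ℕ.suc (ℕ.suc _)))))))))
    (ℕ.s≤s (ℕ.s≤s (ℕ.s≤s (ℕ.s≤s (ℕ.s≤s (ℕ.s≤s (ℕ.s≤s (ℕ.s≤s (ℕ.s≤s ())))))))))

  W-isHSeq : IsHSeq α W
  W-isHSeq = record
    { h0   = refl
    ; h1   = refl
    ; h2   = trans (W-shape 2) (trans (negate (α ^ 2) ((α - 1ℤ) ^ 1) (γ α ^ 1))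
                   (cong₂ (λ b c → - (α ^ 2 * b * c)) (*-identityʳ (α - 1ℤ)) (*-identityʳ (γ α))))
    ; h3   = trans (W-shape 3) (negate (α ^ 6) ((α - 1ℤ) ^ 3) (γ α ^ 3))
    ; h4   = trans (W-shape 4) (cong (λ a → a * (α - 1ℤ) ^ 6 * γ α ^ 5) (*-identityˡ (α ^ 12)))
    ; odd  = odd-all
    ; even = even-all
    }
    where
    odd-all : ∀ m → 2 ℕ.≤ m → OddRel W m
    odd-all 1                 (ℕ.s≤s ())
    odd-all (ℕ.suc (ℕ.suc m)) _ = odd-everywhere odd-window (ℕ.suc m)
    even-all : ∀ m → 3 ℕ.≤ m → EvenRel W m
    even-all 1                          (ℕ.s≤s ())
    even-all 2                          (ℕ.s≤s (ℕ.s≤s ()))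
    even-all (ℕ.suc (ℕ.suc (ℕ.suc m))) _ = even-everywhere even-window (ℕ.suc m)
    negate : ∀ a b c → -1ℤ * a * b * c ≡ - (a * b * c)
    negate = solve-∀

  -- Moving three blocks up multiplies W by a nonzero cube, so whether W n is a
  -- cube depends only on n mod 27; on the residues it is read off the exponents.
  module Cubicity (α≢0 : α ≢ 0ℤ) (α≢1 : α ≢ 1ℤ) where

    pw≢0 : ∀ a b → pw a b ≢ 0ℤ
    pw≢0 a b = *-≢0 (^-≢0 a (mono≢0 α≢0 α≢1 expA)) (^-≢0 b (mono≢0 α≢0 α≢1 expB))

    -- Three blocks up: θ (3p) t = (A^(3p²) B^(p t))³.
    W-27 : ∀ p t → W (9 ℕ.* (3 ℕ.* p) ℕ.+ t) ≡ W t * pw (3 ℕ.* (p ℕ.* p)) (p ℕ.* t) ^ 3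
    W-27 p t = trans (W-shift (3 ℕ.* p) t)
      (cong (W t *_) (trans (cong₂ pw (quadratic p) (linear p t)) (sym (pw-^ (3 ℕ.* (p ℕ.* p)) (p ℕ.* t) 3))))
      where
      quadratic : ∀ p → 3 ℕ.* p ℕ.* (3 ℕ.* p) ≡ 3 ℕ.* (3 ℕ.* (p ℕ.* p))
      quadratic = ℕ-Solver.solve-∀
      linear : ∀ p t → 3 ℕ.* p ℕ.* t ≡ 3 ℕ.* (p ℕ.* t)
      linear = ℕ-Solver.solve-∀

    cube-mod-27 : ∀ n → IsCube (W n) ⇔ IsCube (W (n ℕ.% 27))
    cube-mod-27 n = subst (λ x → IsCube x ⇔ IsCube (W t)) (sym (trans (cong W split) (W-27 p t)))
                          (cube-factor (pw≢0 (3 ℕ.* (p ℕ.* p)) (p ℕ.* t)))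
      where
      t = n ℕ.% 27
      p = n ℕ./ 27
      reorder : ∀ t p → t ℕ.+ p ℕ.* 27 ≡ 9 ℕ.* (3 ℕ.* p) ℕ.+ t
      reorder = ℕ-Solver.solve-∀
      split : n ≡ 9 ℕ.* (3 ℕ.* p) ℕ.+ t
      split = trans (m≡m%n+[m/n]*n n 27) (reorder t p)

    -- The exponent vector of a nonzero term, and its exponents divided by 3
    -- (the sign exponent kept: only its parity matters).
    exponents : Term → Exp
    exponents (just e) = e
    exponents nothing  = ⟨ 0 , 0 , 0 , 0 ⟩

    cube-root : Exp → Exp
    cube-root ⟨ s , a , b , c ⟩ = ⟨ s , a ℕ./ 3 , b ℕ./ 3 , c ℕ./ 3 ⟩

    cube-residue : ∀ t → ⟦ shape t ⟧ ≡ mono (3 ⊙ cube-root (exponents (shape t))) → IsCube (W t)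
    cube-residue t shape≡ = mono u , mono≢0 α≢0 α≢1 u , trans (W-shape t) (trans shape≡ (mono-⊙ 3 u))
      where u = cube-root (exponents (shape t))

    γ²-residue : ∀ t → ⟦ shape t ⟧ ≡ mono (⟨ 0 , 0 , 0 , 2 ⟩ ⊕ 3 ⊙ cube-root (exponents (shape t))) →
                 IsCube (W t) ⇔ IsCube (γ α ^ 2)
    γ²-residue t shape≡ = subst (λ x → IsCube x ⇔ IsCube (γ α ^ 2)) (sym W≡γ²u³) (cube-factor (mono≢0 α≢0 α≢1 u))
      where
      u = cube-root (exponents (shape t))
      W≡γ²u³ : W t ≡ γ α ^ 2 * mono u ^ 3
      W≡γ²u³ = trans (W-shape t) (trans shape≡ (trans (mono-⊕ ⟨ 0 , 0 , 0 , 2 ⟩ (3 ⊙ u))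
                 (cong₂ _*_ (*-identityˡ (γ α ^ 2)) (mono-⊙ 3 u))))

    cube-residues : ∀ t → t ≡ 1 ⊎ t ≡ 3 ⊎ t ≡ 6 ⊎ t ≡ 12 ⊎ t ≡ 15 ⊎ t ≡ 21 ⊎ t ≡ 24 ⊎ t ≡ 26 → IsCube (W t)
    cube-residues _ (inj₁ refl)                                          = cube-residue 1 refl
    cube-residues _ (inj₂ (inj₁ refl))                                   = cube-residue 3 refl
    cube-residues _ (inj₂ (inj₂ (inj₁ refl)))                            = cube-residue 6 refl
    cube-residues _ (inj₂ (inj₂ (inj₂ (inj₁ refl))))                     = cube-residue 12 refl
    cube-residues _ (inj₂ (inj₂ (inj₂ (inj₂ (inj₁ refl)))))              = cube-residue 15 refl
    cube-residues _ (inj₂ (inj₂ (inj₂ (inj₂ (inj₂ (inj₁ refl))))))       = cube-residue 21 refl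
    cube-residues _ (inj₂ (inj₂ (inj₂ (inj₂ (inj₂ (inj₂ (inj₁ refl))))))) = cube-residue 24 refl
    cube-residues _ (inj₂ (inj₂ (inj₂ (inj₂ (inj₂ (inj₂ (inj₂ refl))))))) = cube-residue 26 refl

    γ²-residues : ∀ t → t ≡ 4 ⊎ t ≡ 23 → IsCube (W t) ⇔ IsCube (γ α ^ 2)
    γ²-residues _ (inj₁ refl) = γ²-residue 4 refl
    γ²-residues _ (inj₂ refl) = γ²-residue 23 refl

theorem5p17 : (α : ℤ) → α ≢ 0ℤ → α ≢ 1ℤ → (h : ℕ → ℤ) → IsHSeq α h →
    ((n : ℕ) →
      (n % 27 ≡ 1 ⊎ n % 27 ≡ 3 ⊎ n % 27 ≡ 6 ⊎ n % 27 ≡ 12 ⊎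
       n % 27 ≡ 15 ⊎ n % 27 ≡ 21 ⊎ n % 27 ≡ 24 ⊎ n % 27 ≡ 26) →
      IsCube (h n))
    ×
    ((n : ℕ) → (n % 27 ≡ 4 ⊎ n % 27 ≡ 23) →
      (IsCube (h n) ⇔ IsCube (γ α ^ 2)))
theorem5p17 α α≢0 α≢1 h h-seq = part-i , part-ii
  where
  open Order9 α
  open Cubicity α≢0 α≢1
  open Monomials α using (mono≢0)
  -- h 2 = W 2 is a nonzero monomial, so h coincides with the closed form W.
  h₂≢0 : h 2 ≢ 0ℤ
  h₂≢0 h₂≡0 = mono≢0 α≢0 α≢1 ⟨ 1 , 2 , 1 , 1 ⟩
    (trans (sym (W-shape 2)) (trans (IsHSeq.h2 W-isHSeq) (trans (sym (IsHSeq.h2 h-seq)) h₂≡0)))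
  h≡W : ∀ n → h n ≡ W n
  h≡W = hseq-unique h-seq W-isHSeq h₂≢0
  reduce : ∀ n → IsCube (h n) ⇔ IsCube (W (n % 27))
  reduce n = subst (λ x → IsCube x ⇔ IsCube (W (n % 27))) (sym (h≡W n)) (cube-mod-27 n)
  part-i : ∀ n → n % 27 ≡ 1 ⊎ n % 27 ≡ 3 ⊎ n % 27 ≡ 6 ⊎ n % 27 ≡ 12 ⊎
                 n % 27 ≡ 15 ⊎ n % 27 ≡ 21 ⊎ n % 27 ≡ 24 ⊎ n % 27 ≡ 26 → IsCube (h n)
  part-i n residue = Equivalence.from (reduce n) (cube-residues (n % 27) residue)
  part-ii : ∀ n → n % 27 ≡ 4 ⊎ n % 27 ≡ 23 → IsCube (h n) ⇔ IsCube (γ α ^ 2)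
  part-ii n residue = ⇔-trans (reduce n) (γ²-residues (n % 27) residue)
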